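{- For every integer $n\geq 3$, any two adjacent vertices of the augmented cube $AQ_n$ have either exactly two or exactly four common neighbors.
   Context: The $n$-dimensional augmented cube $AQ_n$ has as vertex set all $n$-bit binary strings $X=x_nx_{n-1}\cdots x_1$. For $1\le i\le n$ let $X_i=x_n\cdots x_{i+1}\bar x_i x_{i-1}\cdots x_1$ (flip bit $i$) and $\overline{X}_i=x_n\cdots x_{i+1}\bar x_i\bar x_{i-1}\cdots\bar x_1$ (flip bits $i,i-1,\dots,1$). Two distinct vertices $X,Y$ are adjacent iff $Y=X_i$ for some $1\le i\le n$ or $Y=\overline{X}_i$ for some $2\le i\le n$. -}

module Defs where

open import Data.Nat using (ℕ; zero; suc; _<_; _≤_; _≟_; _<?_; _≤?_)
open import Data.Nat.Properties using ()
open import Data.Bool using (Bool; true; false; not; if_then_else_)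
open import Data.Fin using (Fin; toℕ)
open import Data.Vec.Functional using (Vector)
open import Data.Vec using (Vec; []; _∷_; tabulate; lookup)
import Data.Vec.Properties as VP
open import Data.List using (List; []; _∷_; map; _++_; length; filter)
open import Data.Product using (Σ; ∃; _×_; _,_)
open import Data.Sum using (_⊎_)
open import Relation.Nullary using (¬_; Dec; yes; no)
open import Relation.Nullary.Decidable using (⌊_⌋)
open import Relation.Binary.PropositionalEquality using (_≡_; _≢_)

-- A vertex of AQ n is an n-bit string X = x_n x_(n-1) ... x_1.
-- We represent it as a  Vec Bool n  where position k
-- (with toℕ k = i - 1) holds the bit x_i.
Vertex : ℕ → Set
Vertex n = Vec Bool n

flipBit : ∀ {n} → ℕ → Vertex n → Vertex n
flipBit {n} i X = tabulate λ k →
  if ⌊ suc (toℕ k) ≟ i ⌋ then not (lookup X k) else lookup X k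

flipUpTo : ∀ {n} → ℕ → Vertex n → Vertex n
flipUpTo {n} i X = tabulate λ k →
  if ⌊ suc (toℕ k) ≤? i ⌋ then not (lookup X k) else lookup X k

Adjacent : (n : ℕ) → Vertex n → Vertex n → Set
Adjacent n X Y =
  X ≢ Y ×
  ( (Σ ℕ λ i → 1 ≤ i × i ≤ n × Y ≡ flipBit i X)
  ⊎ (Σ ℕ λ i → 2 ≤ i × i ≤ n × Y ≡ flipUpTo i X) )

CommonNeighbour : (n : ℕ) → Vertex n → Vertex n → Vertex n → Set
CommonNeighbour n X Y Z = Adjacent n X Z × Adjacent n Y Z

-- AQ n is the Cayley graph of (ℤ₂)ⁿ for the generators e_i (flip bit i, 1 ≤ i ≤ n) and
-- u_i = e_1 + ⋯ + e_i (flip bits i, …, 1, 2 ≤ i ≤ n). So X + s is a common neighbour of X and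
-- X + d exactly when s + d is again a generator t, i.e. s, d, t is a triangle: three generators
-- summing to 0. Comparing the three masks at a few well-chosen positions shows that the
-- triangles are exactly {e_1, e_2, u_2} and {u_i, e_(i+1), u_(i+1)} for 2 ≤ i < n. Every generator
-- lies in exactly one of them, except u_i with 2 ≤ i < n, which lies in two; each triangle
-- through d contributes its two other members, giving 2 or 4 common neighbours.
module Submission where

open import Defs
open import Data.Bool using (Bool; true; false; not; if_then_else_; _xor_)
open import Data.Bool.Properties using (xor-assoc; xor-comm; xor-same; T-≡; not-injective)
open import Data.Empty using (⊥-elim)
open import Data.Fin using (toℕ; fromℕ<)
open import Data.Fin.Properties using (toℕ-fromℕ<; toℕ<n)
open import Data.List using (List; []; _∷_; map; length)
open import Data.List.Properties using (length-map)
open import Data.List.Membership.Propositional using (_∈_)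
open import Data.List.Membership.Propositional.Properties using (∈-map⁺; ∈-map⁻)
open import Data.List.Relation.Unary.All using (All; []; _∷_)
import Data.List.Relation.Unary.All as All
import Data.List.Relation.Unary.All.Properties as All
open import Data.List.Relation.Unary.AllPairs using ([]; _∷_)
open import Data.List.Relation.Unary.Any using (here; there)
open import Data.List.Relation.Unary.Unique.Propositional using (Unique)
open import Data.Nat using (ℕ; suc; 2+; _+_; _≤_; _<_; _≟_; _≤?_; z≤n; s≤s)
open import Data.Nat.Properties
  using (<-cmp; <-irrefl; <-trans; <⇒≢; n≤1+n; ≤-refl; ≤-trans; ≤-antisym; ≤-pred; ≰⇒>; <⇒≤; <⇒≱; <-≤-trans; n<1+n)
open import Data.Product using (Σ; _×_; _,_; proj₁; proj₂)
open import Data.Sum using (_⊎_; inj₁; inj₂)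
import Data.Sum as Sum
open import Data.Vec using (tabulate; lookup)
open import Data.Vec.Properties using (lookup∘tabulate; tabulate∘lookup; tabulate-cong)
open import Function using (_∘_)
open import Function.Bundles using (_⇔_; mk⇔; Equivalence)
open import Relation.Binary.Definitions using (tri<; tri≈; tri>)
open import Relation.Binary.PropositionalEquality
  using (_≡_; _≢_; ≢-sym; refl; sym; trans; cong; cong₂; subst; module ≡-Reasoning)
open import Relation.Nullary using (¬_; Dec; yes; no; contradiction)
open import Relation.Nullary.Decidable using (⌊_⌋; isYes≗does; dec-true; dec-false; toWitness)

xor-cancelʳ : ∀ {a b} x → a xor x ≡ b xor x → a ≡ b
xor-cancelʳ {false} {false} _ _ = refl
xor-cancelʳ {true}  {true}  _ _ = refl
xor-cancelʳ {false} {true}  false ()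
xor-cancelʳ {false} {true}  true  ()
xor-cancelʳ {true}  {false} false ()
xor-cancelʳ {true}  {false} true  ()

xor-sameˡ : ∀ x y → x xor (x xor y) ≡ y
xor-sameˡ x y = trans (sym (xor-assoc x x y)) (cong (_xor y) (xor-same x))

xor³≡false⇒ : ∀ {x} y z → x xor y xor z ≡ false → x ≡ z xor y
xor³≡false⇒ y z e = trans (xor-cancelʳ (y xor z) (trans e (sym (xor-same (y xor z))))) (xor-comm y z)

≡xor⇒xor³≡false : ∀ {x} y z → x ≡ z xor y → x xor y xor z ≡ false
≡xor⇒xor³≡false y z refl = trans (cong ((z xor y) xor_) (xor-comm y z)) (xor-same (z xor y))

xor≡true : ∀ {x y} → x xor y ≡ true → (x ≡ true × y ≡ false) ⊎ (x ≡ false × y ≡ true)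
xor≡true {true}  {false} _ = inj₁ (refl , refl)
xor≡true {false} {true}  _ = inj₂ (refl , refl)

if-not≡xor : ∀ b x → (if b then not x else x) ≡ b xor x
if-not≡xor true  _ = refl
if-not≡xor false _ = refl

isYes-true : ∀ {p} {P : Set p} (P? : Dec P) → P → ⌊ P? ⌋ ≡ true
isYes-true P? p = trans (isYes≗does P?) (dec-true P? p)

isYes-false : ∀ {p} {P : Set p} (P? : Dec P) → ¬ P → ⌊ P? ⌋ ≡ false
isYes-false P? ¬p = trans (isYes≗does P?) (dec-false P? ¬p)

isYes-true⁻ : ∀ {p} {P : Set p} (P? : Dec P) → ⌊ P? ⌋ ≡ true → P
isYes-true⁻ P? e = toWitness (Equivalence.from T-≡ e)

unique-map⁺ : ∀ {A B : Set} {P : A → Set} (f : A → B) → (∀ {x y} → P x → P y → f x ≡ f y → x ≡ y) →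
  ∀ {xs} → All P xs → Unique xs → Unique (map f xs)
unique-map⁺ f inj [] [] = []
unique-map⁺ f inj (px ∷ pxs) (x∉xs ∷ u) =
  All.map⁺ (All.zipWith (λ (py , x≢y) → x≢y ∘ inj px py) (pxs , x∉xs)) ∷ unique-map⁺ f inj pxs u

AgreeOn : ℕ → (ℕ → Bool) → (ℕ → Bool) → Set
AgreeOn n f g = ∀ j → 1 ≤ j → j ≤ n → f j ≡ g j

-- Bit positions are numbered 1, …, n as in the paper: position j lives at index j - 1 of the vector.
flipBy : ∀ {n} → (ℕ → Bool) → Vertex n → Vertex n
flipBy m X = tabulate λ k → m (suc (toℕ k)) xor lookup X k

flipBy-false : ∀ {n} (X : Vertex n) → flipBy (λ _ → false) X ≡ X
flipBy-false X = tabulate∘lookup X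

flipBy-flipBy : ∀ {n} m m' (X : Vertex n) → flipBy m (flipBy m' X) ≡ flipBy (λ j → m j xor m' j) X
flipBy-flipBy m m' X = tabulate-cong λ k →
  trans (cong (m _ xor_) (lookup∘tabulate _ k)) (sym (xor-assoc (m _) (m' _) (lookup X k)))

flipBy-injective : ∀ {n} {m m'} (X : Vertex n) → flipBy m X ≡ flipBy m' X → AgreeOn n m m'
flipBy-injective {m = m} {m'} X e (suc j) _ j<n = subst (λ i → m (suc i) ≡ m' (suc i)) (toℕ-fromℕ< j<n)
  (xor-cancelʳ (lookup X k)
    (trans (sym (lookup∘tabulate _ k)) (trans (cong (λ V → lookup V k) e) (lookup∘tabulate _ k))))
  where k = fromℕ< j<n

flipBy-cong : ∀ {n} {m m'} (X : Vertex n) → AgreeOn n m m' → flipBy m X ≡ flipBy m' X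
flipBy-cong X H = tabulate-cong λ k → cong (_xor lookup X k) (H (suc (toℕ k)) (s≤s z≤n) (toℕ<n k))

data Generator : Set where
  bit upTo : ℕ → Generator

mask : Generator → ℕ → Bool
mask (bit i)  j = ⌊ j ≟ i ⌋
mask (upTo i) j = ⌊ j ≤? i ⌋

act : ∀ {n} → Generator → Vertex n → Vertex n
act (bit i)  = flipBit i
act (upTo i) = flipUpTo i

Valid : ℕ → Generator → Set
Valid n (bit i)  = 1 ≤ i × i ≤ n
Valid n (upTo i) = 2 ≤ i × i ≤ n

act≡flipBy : ∀ {n} g (X : Vertex n) → act g X ≡ flipBy (mask g) X
act≡flipBy (bit i)  X = tabulate-cong λ k → if-not≡xor (mask (bit i) (suc (toℕ k))) (lookup X k)
act≡flipBy (upTo i) X = tabulate-cong λ k → if-not≡xor (mask (upTo i) (suc (toℕ k))) (lookup X k)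

mask-bit-self : ∀ i → mask (bit i) i ≡ true
mask-bit-self i = isYes-true (i ≟ i) refl

mask-bit-other : ∀ {i j} → j ≢ i → mask (bit i) j ≡ false
mask-bit-other {i} {j} = isYes-false (j ≟ i)

mask-bit⁻ : ∀ {i j} → mask (bit i) j ≡ true → j ≡ i
mask-bit⁻ {i} {j} = isYes-true⁻ (j ≟ i)

mask-upTo-≤ : ∀ {i j} → j ≤ i → mask (upTo i) j ≡ true
mask-upTo-≤ {i} {j} = isYes-true (j ≤? i)

mask-upTo-> : ∀ {i j} → i < j → mask (upTo i) j ≡ false
mask-upTo-> {i} {j} i<j = isYes-false (j ≤? i) (<⇒≱ i<j)

mask-upTo⁻ : ∀ {i j} → mask (upTo i) j ≡ true → j ≤ i
mask-upTo⁻ {i} {j} = isYes-true⁻ (j ≤? i)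

mask-upTo-false⁻ : ∀ {i j} → mask (upTo i) j ≡ false → i < j
mask-upTo-false⁻ e = ≰⇒> λ j≤i → contradiction (trans (sym (mask-upTo-≤ j≤i)) e) λ ()

mask-nonzero : ∀ {n} g → Valid n g → Σ ℕ λ j → 1 ≤ j × j ≤ n × mask g j ≡ true
mask-nonzero (bit i)  (1≤i , i≤n) = i , 1≤i , i≤n , mask-bit-self i
mask-nonzero (upTo i) (2≤i , i≤n) = 1 , s≤s z≤n , ≤-trans 1≤i i≤n , mask-upTo-≤ 1≤i
  where 1≤i = ≤-trans (s≤s z≤n) 2≤i

act-moves : ∀ {n} g → Valid n g → (X : Vertex n) → X ≢ act g X
act-moves g vg X X≡gX with mask-nonzero g vg
... | j , 1≤j , j≤n , gⱼ≡true =
  contradiction (trans (flipBy-injective {m = λ _ → false} {mask g} X X≡flip j 1≤j j≤n) gⱼ≡true) λ ()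
  where
  X≡flip : flipBy (λ _ → false) X ≡ flipBy (mask g) X
  X≡flip = trans (flipBy-false X) (trans X≡gX (act≡flipBy g X))

adjacent⇔ : ∀ {n} {X Z : Vertex n} → Adjacent n X Z ⇔ (Σ Generator λ g → Valid n g × Z ≡ act g X)
adjacent⇔ {n} {X} {Z} = mk⇔ to from
  where
  to : Adjacent n X Z → Σ Generator λ g → Valid n g × Z ≡ act g X
  to (_ , inj₁ (i , 1≤i , i≤n , e)) = bit i , (1≤i , i≤n) , e
  to (_ , inj₂ (i , 2≤i , i≤n , e)) = upTo i , (2≤i , i≤n) , e
  from : (Σ Generator λ g → Valid n g × Z ≡ act g X) → Adjacent n X Z
  from (bit i  , vg@(1≤i , i≤n) , refl) = act-moves (bit i) vg X , inj₁ (i , 1≤i , i≤n , refl)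
  from (upTo i , vg@(2≤i , i≤n) , refl) = act-moves (upTo i) vg X , inj₂ (i , 2≤i , i≤n , refl)

mask-bit≉upTo : ∀ {n a b} → Valid n (bit a) → Valid n (upTo b) → ¬ AgreeOn n (mask (bit a)) (mask (upTo b))
mask-bit≉upTo {a = 1}    _ (2≤b , b≤n) H =
  contradiction (trans (H 2 (s≤s z≤n) (≤-trans 2≤b b≤n)) (mask-upTo-≤ 2≤b)) λ ()
mask-bit≉upTo {a = 2+ _} _ (2≤b , b≤n) H =
  contradiction (trans (H 1 (s≤s z≤n) (≤-trans 1≤b b≤n)) (mask-upTo-≤ 1≤b)) λ ()
  where 1≤b = ≤-trans (s≤s z≤n) 2≤b

mask-injective : ∀ {n} {g g'} → Valid n g → Valid n g' → AgreeOn n (mask g) (mask g') → g ≡ g'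
mask-injective {g = bit a} {bit b} (1≤a , a≤n) _ H =
  cong bit (mask-bit⁻ (trans (sym (H a 1≤a a≤n)) (mask-bit-self a)))
mask-injective {g = upTo a} {upTo b} (2≤a , a≤n) (2≤b , b≤n) H = cong upTo (≤-antisym
  (mask-upTo⁻ (trans (sym (H a (≤-trans (s≤s z≤n) 2≤a) a≤n)) (mask-upTo-≤ (≤-refl {a}))))
  (mask-upTo⁻ (trans (H b (≤-trans (s≤s z≤n) 2≤b) b≤n) (mask-upTo-≤ (≤-refl {b})))))
mask-injective {g = bit _}  {upTo _} va vb H = contradiction H (mask-bit≉upTo va vb)
mask-injective {g = upTo _} {bit _}  va vb H = contradiction (λ j p q → sym (H j p q)) (mask-bit≉upTo vb va)

act-injective : ∀ {n} {g g'} (X : Vertex n) → Valid n g → Valid n g' → act g X ≡ act g' X → g ≡ g'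
act-injective {g = g} {g'} X vg vg' e =
  mask-injective vg vg' (flipBy-injective X (trans (sym (act≡flipBy g X)) (trans e (act≡flipBy g' X))))

record SumsToZero (n : ℕ) (a b c : Generator) : Set where
  constructor sumsToZero
  field vanishes : ∀ j → 1 ≤ j → j ≤ n → mask a j xor mask b j xor mask c j ≡ false
open SumsToZero

sumsToZero-swap : ∀ {n a b c} → SumsToZero n a b c → SumsToZero n b a c
sumsToZero-swap {a = a} {b} {c} σ = sumsToZero λ j p q →
  trans (xor-swap (mask b j) (mask a j) (mask c j)) (vanishes σ j p q)
  where
  xor-swap : ∀ x y z → x xor y xor z ≡ y xor x xor z
  xor-swap x y z = trans (sym (xor-assoc x y z)) (trans (cong (_xor z) (xor-comm x y)) (xor-assoc y x z))

sumsToZero-rotate : ∀ {n a b c} → SumsToZero n a b c → SumsToZero n b c a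
sumsToZero-rotate {a = a} {b} {c} σ = sumsToZero λ j p q →
  trans (sym (xor-assoc (mask b j) (mask c j) (mask a j)))
        (trans (xor-comm (mask b j xor mask c j) (mask a j)) (vanishes σ j p q))

act∘act≡act⇔sumsToZero : ∀ {n} s d t (X : Vertex n) → act s X ≡ act t (act d X) ⇔ SumsToZero n s d t
act∘act≡act⇔sumsToZero {n} s d t X = mk⇔
  (λ e → sumsToZero λ j p q → ≡xor⇒xor³≡false (mask d j) (mask t j) (agree e j p q))
  (λ σ → begin
    act s X           ≡⟨ act≡flipBy s X ⟩
    flipBy (mask s) X ≡⟨ flipBy-cong {m = mask s} {td} X
                           (λ j p q → xor³≡false⇒ (mask d j) (mask t j) (vanishes σ j p q)) ⟩
    flipBy td X       ≡⟨ sym act∘act≡flipBy ⟩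
    act t (act d X)   ∎)
  where
  open ≡-Reasoning
  td : ℕ → Bool
  td j = mask t j xor mask d j
  act∘act≡flipBy : act t (act d X) ≡ flipBy td X
  act∘act≡flipBy = begin
    act t (act d X)              ≡⟨ act≡flipBy t (act d X) ⟩
    flipBy (mask t) (act d X)    ≡⟨ cong (flipBy (mask t)) (act≡flipBy d X) ⟩
    flipBy (mask t) (flipBy (mask d) X) ≡⟨ flipBy-flipBy (mask t) (mask d) X ⟩
    flipBy td X                  ∎
  agree : act s X ≡ act t (act d X) → AgreeOn n (mask s) td
  agree e = flipBy-injective {m = mask s} {td} X (trans (sym (act≡flipBy s X)) (trans e act∘act≡flipBy))

Triangle : ℕ → Generator → Generator → Generator → Set
Triangle n a b c = Valid n a × Valid n b × Valid n c × SumsToZero n a b c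

triangle-swap : ∀ {n a b c} → Triangle n a b c → Triangle n b a c
triangle-swap (va , vb , vc , σ) = vb , va , vc , sumsToZero-swap σ

triangle-rotate : ∀ {n a b c} → Triangle n a b c → Triangle n b c a
triangle-rotate (va , vb , vc , σ) = vb , vc , va , sumsToZero-rotate σ

Partner : ℕ → Generator → Generator → Set
Partner n d s = Σ Generator (Triangle n s d)

partner-valid : ∀ {n d s} → Partner n d s → Valid n s
partner-valid (_ , vs , _) = vs

commonNeighbour⇔ : ∀ {n d} {Z : Vertex n} (X : Vertex n) → Valid n d →
  CommonNeighbour n X (act d X) Z ⇔ (Σ Generator λ s → Partner n d s × Z ≡ act s X)
commonNeighbour⇔ {n} {d} {Z} X vd = mk⇔ to from
  where
  to : CommonNeighbour n X (act d X) Z → Σ Generator λ s → Partner n d s × Z ≡ act s X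
  to (adj₁ , adj₂) with Equivalence.to adjacent⇔ adj₁ | Equivalence.to adjacent⇔ adj₂
  ... | s , vs , refl | t , vt , e =
    s , (t , vs , vd , vt , Equivalence.to (act∘act≡act⇔sumsToZero s d t X) e) , refl
  from : (Σ Generator λ s → Partner n d s × Z ≡ act s X) → CommonNeighbour n X (act d X) Z
  from (s , (t , vs , _ , vt , σ) , refl) =
    Equivalence.from adjacent⇔ (s , vs , refl) ,
    Equivalence.from adjacent⇔ (t , vt , Equivalence.from (act∘act≡act⇔sumsToZero s d t X) σ)

triangle-low : ∀ {n} → 2 ≤ n → Triangle n (bit 1) (bit 2) (upTo 2)
triangle-low 2≤n = (s≤s z≤n , <⇒≤ 2≤n) , (s≤s z≤n , 2≤n) , (≤-refl , 2≤n) , sumsToZero vanishes-low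
  where
  vanishes-low : ∀ j → 1 ≤ j → j ≤ _ → mask (bit 1) j xor mask (bit 2) j xor mask (upTo 2) j ≡ false
  vanishes-low 1            _ _ = refl
  vanishes-low 2            _ _ = refl
  vanishes-low (2+ (suc _)) _ _ = refl

upTo-bit-upTo-vanishes : ∀ i j → mask (upTo i) j xor mask (bit (suc i)) j xor mask (upTo (suc i)) j ≡ false
upTo-bit-upTo-vanishes i j with <-cmp j (suc i)
... | tri< j≤i _ _ = cong₂ _xor_ (mask-upTo-≤ (≤-pred j≤i))
                      (cong₂ _xor_ (mask-bit-other (<⇒≢ j≤i)) (mask-upTo-≤ (<⇒≤ j≤i)))
... | tri≈ _ refl _ = cong₂ _xor_ (mask-upTo-> (n<1+n i))
                       (cong₂ _xor_ (mask-bit-self (suc i)) (mask-upTo-≤ (≤-refl {suc i})))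
... | tri> _ _ 1+i<j = cong₂ _xor_ (mask-upTo-> (<-trans (n<1+n i) 1+i<j))
                        (cong₂ _xor_ (mask-bit-other (≢-sym (<⇒≢ 1+i<j))) (mask-upTo-> 1+i<j))

triangle-step : ∀ {n i} → 2 ≤ i → suc i ≤ n → Triangle n (upTo i) (bit (suc i)) (upTo (suc i))
triangle-step {i = i} 2≤i i<n = (2≤i , <⇒≤ i<n) , (s≤s z≤n , i<n) , (≤-trans 2≤i (n≤1+n i) , i<n) ,
  sumsToZero λ j _ _ → upTo-bit-upTo-vanishes i j

sumsToZero-at : ∀ {n a b c j x y z} → SumsToZero n a b c → 1 ≤ j → j ≤ n →
  mask a j ≡ x → mask b j ≡ y → mask c j ≡ z → x xor y xor z ≡ false
sumsToZero-at σ 1≤j j≤n refl refl refl = vanishes σ _ 1≤j j≤n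

bit-bit²-impossible : ∀ {n a c} → Valid n (bit c) → ¬ SumsToZero n (bit a) (bit a) (bit c)
bit-bit²-impossible {a = a} {c} (1≤c , c≤n) σ =
  contradiction (trans (sym (mask-bit-self c)) (trans (sym (xor-sameˡ (mask (bit a) c) _)) (vanishes σ c 1≤c c≤n)))
    λ ()

-- Position a forces a to equal b or c, and then the remaining bit is left uncancelled.
bit³-impossible : ∀ {n a b c} → Valid n (bit a) → Valid n (bit b) → Valid n (bit c) →
  ¬ SumsToZero n (bit a) (bit b) (bit c)
bit³-impossible {a = a} {b} {c} (1≤a , a≤n) vb vc σ with a ≟ b
... | yes refl = bit-bit²-impossible vc σ
... | no a≢b with mask-bit⁻ (not-injective {y = true}
                 (sumsToZero-at σ 1≤a a≤n (mask-bit-self a) (mask-bit-other a≢b) refl))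
... | refl = bit-bit²-impossible vb (sumsToZero-rotate (sumsToZero-rotate σ))

upTo³-impossible : ∀ {n a b c} → Valid n (upTo a) → Valid n (upTo b) → Valid n (upTo c) →
  ¬ SumsToZero n (upTo a) (upTo b) (upTo c)
upTo³-impossible (2≤a , a≤n) (2≤b , _) (2≤c , _) σ = contradiction
  (sumsToZero-at σ (s≤s z≤n) (≤-trans (<⇒≤ 2≤a) a≤n)
    (mask-upTo-≤ (<⇒≤ 2≤a)) (mask-upTo-≤ (<⇒≤ 2≤b)) (mask-upTo-≤ (<⇒≤ 2≤c)))
  λ ()

mask-upTo-3⁻ : ∀ {c} → 2 ≤ c → mask (upTo c) 3 ≡ false → c ≡ 2
mask-upTo-3⁻ 2≤c e = ≤-antisym (≤-pred (mask-upTo-false⁻ e)) 2≤c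

-- Positions 1 and 2 force {a, b} = {1, 2}; position 3 then forces c = 2.
bit-bit-upTo : ∀ {n a b c} → 3 ≤ n → Valid n (upTo c) → SumsToZero n (bit a) (bit b) (upTo c) →
  c ≡ 2 × ((a ≡ 1 × b ≡ 2) ⊎ (a ≡ 2 × b ≡ 1))
bit-bit-upTo {n} {a} {b} {c} 3≤n (2≤c , _) σ with hits 1 (s≤s z≤n) (s≤s z≤n) | hits 2 (s≤s z≤n) ≤-refl
  where
  hits : ∀ j → 1 ≤ j → j ≤ 2 → j ≡ a ⊎ j ≡ b
  hits j 1≤j j≤2 = Sum.map (mask-bit⁻ ∘ proj₁) (mask-bit⁻ ∘ proj₂) (xor≡true (not-injective {y = true}
    (sumsToZero-at (sumsToZero-rotate (sumsToZero-rotate σ)) 1≤j (≤-trans j≤2 (<⇒≤ 3≤n))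
      (mask-upTo-≤ (≤-trans j≤2 2≤c)) refl refl)))
... | inj₁ refl | inj₂ refl = mask-upTo-3⁻ 2≤c (vanishes σ 3 (s≤s z≤n) 3≤n) , inj₁ (refl , refl)
... | inj₂ refl | inj₁ refl = mask-upTo-3⁻ 2≤c (vanishes σ 3 (s≤s z≤n) 3≤n) , inj₂ (refl , refl)
... | inj₁ refl | inj₁ ()
... | inj₂ refl | inj₂ ()

bit-upTo-upTo-ordered : ∀ {n a b c} → Valid n (bit a) → Valid n (upTo b) → c < a → a ≤ b →
  SumsToZero n (bit a) (upTo b) (upTo c) → b ≡ a × suc c ≡ a
bit-upTo-upTo-ordered {a = a} {b} {c} (_ , a≤n) (2≤b , b≤n) c<a a≤b σ = mask-bit⁻ at-b , mask-bit⁻ at-1+c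
  where
  at-b : mask (bit a) b ≡ true
  at-b = xor³≡false⇒ true false
    (sumsToZero-at σ (<⇒≤ 2≤b) b≤n refl (mask-upTo-≤ (≤-refl {b})) (mask-upTo-> (<-≤-trans c<a a≤b)))
  at-1+c : mask (bit a) (suc c) ≡ true
  at-1+c = xor³≡false⇒ true false
    (sumsToZero-at σ (s≤s z≤n) (≤-trans c<a a≤n) refl (mask-upTo-≤ (≤-trans c<a a≤b)) (mask-upTo-> (n<1+n c)))

-- At position a exactly one of u_b, u_c is on; that one must be u_a and the other u_(a-1).
bit-upTo-upTo : ∀ {n a b c} → Valid n (bit a) → Valid n (upTo b) → Valid n (upTo c) →
  SumsToZero n (bit a) (upTo b) (upTo c) → (b ≡ a × suc c ≡ a) ⊎ (c ≡ a × suc b ≡ a)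
bit-upTo-upTo {a = a} va@(1≤a , a≤n) vb vc σ
  with xor≡true (not-injective {y = true} (sumsToZero-at σ 1≤a a≤n (mask-bit-self a) refl refl))
... | inj₁ (a≤b , c<a) = inj₁ (bit-upTo-upTo-ordered va vb (mask-upTo-false⁻ c<a) (mask-upTo⁻ a≤b) σ)
... | inj₂ (b<a , a≤c) =
  inj₂ (bit-upTo-upTo-ordered va vc (mask-upTo-false⁻ b<a) (mask-upTo⁻ a≤c) (sumsToZero-rotate (sumsToZero-swap σ)))

-- Indices are written 3 + k so that a concrete generator determines its constructor by unification.
data Kind : ℕ → Generator → Set where
  bit₁       : ∀ {n} → Kind n (bit 1)
  bit₂       : ∀ {n} → Kind n (bit 2)
  bit₃₊      : ∀ {n k} → 3 + k ≤ n → Kind n (bit (3 + k))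
  upTo₂      : ∀ {n} → Kind n (upTo 2)
  upTo-inner : ∀ {n k} → 4 + k ≤ n → Kind n (upTo (3 + k))
  upTo-top   : ∀ {k} → Kind (3 + k) (upTo (3 + k))

kind : ∀ {n} d → Valid n d → Kind n d
kind (bit 1)             _ = bit₁
kind (bit 2)             _ = bit₂
kind (bit (2+ (suc k)))  (_ , i≤n) = bit₃₊ i≤n
kind (upTo 1)            (s≤s () , _)
kind (upTo 2)            _ = upTo₂
kind {n} (upTo (2+ (suc k))) (_ , i≤n) with 4 + k ≤? n
... | yes i<n = upTo-inner i<n
... | no  i≮n with ≤-antisym i≤n (≤-pred (≰⇒> i≮n))
...   | refl = upTo-top

partners : ∀ {n d} → Kind n d → List Generator
partners bit₁                   = bit 2 ∷ upTo 2 ∷ []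
partners bit₂                   = bit 1 ∷ upTo 2 ∷ []
partners (bit₃₊ {k = k} _)      = upTo (2 + k) ∷ upTo (3 + k) ∷ []
partners upTo₂                  = bit 2 ∷ bit 1 ∷ bit 3 ∷ upTo 3 ∷ []
partners (upTo-inner {k = k} _) = bit (3 + k) ∷ upTo (2 + k) ∷ bit (4 + k) ∷ upTo (4 + k) ∷ []
partners (upTo-top {k})         = bit (3 + k) ∷ upTo (2 + k) ∷ []

partners-sound : ∀ {n d} → 3 ≤ n → (v : Kind n d) → All (Partner n d) (partners v)
partners-sound 3≤n bit₁ = (upTo 2 , triangle-swap low) ∷ (bit 2 , triangle-rotate (triangle-rotate low)) ∷ []
  where low = triangle-low (<⇒≤ 3≤n)
partners-sound 3≤n bit₂ = (upTo 2 , low) ∷ (bit 1 , triangle-swap (triangle-rotate low)) ∷ []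
  where low = triangle-low (<⇒≤ 3≤n)
partners-sound _ (bit₃₊ {k = k} i≤n) = (upTo (3 + k) , step) ∷ (upTo (2 + k) , triangle-swap (triangle-rotate step)) ∷ []
  where step = triangle-step (s≤s (s≤s z≤n)) i≤n
partners-sound 3≤n upTo₂ =
  (bit 1 , triangle-rotate low) ∷ (bit 2 , triangle-rotate (triangle-swap low)) ∷
  (upTo 3 , triangle-swap step) ∷ (bit 3 , triangle-rotate (triangle-rotate step)) ∷ []
  where low = triangle-low (<⇒≤ 3≤n)
        step = triangle-step ≤-refl 3≤n
partners-sound _ (upTo-inner {k = k} i<n) =
  (upTo (2 + k) , triangle-rotate lower) ∷ (bit (3 + k) , triangle-rotate (triangle-swap lower)) ∷
  (upTo (4 + k) , triangle-swap upper) ∷ (bit (4 + k) , triangle-rotate (triangle-rotate upper)) ∷ []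
  where lower = triangle-step (s≤s (s≤s z≤n)) (<⇒≤ i<n)
        upper = triangle-step (s≤s (s≤s z≤n)) i<n
partners-sound _ (upTo-top {k}) =
  (upTo (2 + k) , triangle-rotate lower) ∷ (bit (3 + k) , triangle-rotate (triangle-swap lower)) ∷ []
  where lower = triangle-step (s≤s (s≤s z≤n)) ≤-refl

∈-partners-bit₁ : ∀ {n} (v : Kind n (bit 1)) → bit 2 ∈ partners v × upTo 2 ∈ partners v
∈-partners-bit₁ bit₁ = here refl , there (here refl)

∈-partners-bit₂ : ∀ {n} (v : Kind n (bit 2)) → bit 1 ∈ partners v × upTo 2 ∈ partners v
∈-partners-bit₂ bit₂ = here refl , there (here refl)

∈-partners-bit₃₊ : ∀ {n i} → 2 ≤ i → (v : Kind n (bit (suc i))) → upTo i ∈ partners v × upTo (suc i) ∈ partners v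
∈-partners-bit₃₊ (s≤s (s≤s _)) (bit₃₊ _) = here refl , there (here refl)

bit₁∈partners-upTo₂ : ∀ {n} (v : Kind n (upTo 2)) → bit 1 ∈ partners v
bit₁∈partners-upTo₂ upTo₂ = there (here refl)

bit∈partners-upTo : ∀ {n i} (v : Kind n (upTo i)) → bit i ∈ partners v
bit∈partners-upTo upTo₂          = here refl
bit∈partners-upTo (upTo-inner _) = here refl
bit∈partners-upTo upTo-top       = here refl

upTo-pred∈partners-upTo : ∀ {n i} → 2 ≤ i → (v : Kind n (upTo (suc i))) → upTo i ∈ partners v
upTo-pred∈partners-upTo (s≤s (s≤s _)) (upTo-inner _) = there (here refl)
upTo-pred∈partners-upTo (s≤s (s≤s _)) upTo-top       = there (here refl)

∈-partners-upTo-above : ∀ {n i} → suc i ≤ n → (v : Kind n (upTo i)) →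
  bit (suc i) ∈ partners v × upTo (suc i) ∈ partners v
∈-partners-upTo-above _   upTo₂          = there (there (here refl)) , there (there (there (here refl)))
∈-partners-upTo-above _   (upTo-inner _) = there (there (here refl)) , there (there (there (here refl)))
∈-partners-upTo-above i<n upTo-top       = contradiction i<n (<-irrefl refl)

partners-complete : ∀ {n d s} → 3 ≤ n → (v : Kind n d) → Partner n d s → s ∈ partners v
partners-complete {d = bit _}  {bit _}  _ _ (bit _ , vs , vd , vt , σ) = ⊥-elim (bit³-impossible vs vd vt σ)
partners-complete {d = upTo _} {upTo _} _ _ (upTo _ , vs , vd , vt , σ) = ⊥-elim (upTo³-impossible vs vd vt σ)
partners-complete {d = bit _} {bit _} 3≤n v (upTo _ , _ , _ , vt , σ) with bit-bit-upTo 3≤n vt σ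
... | _ , inj₁ (refl , refl) = proj₁ (∈-partners-bit₂ v)
... | _ , inj₂ (refl , refl) = proj₁ (∈-partners-bit₁ v)
partners-complete {d = upTo _} {bit _} 3≤n v (bit _ , _ , vd , _ , σ)
  with bit-bit-upTo 3≤n vd (sumsToZero-rotate (sumsToZero-swap σ))
... | refl , inj₁ (refl , refl) = bit₁∈partners-upTo₂ v
... | refl , inj₂ (refl , refl) = bit∈partners-upTo v
partners-complete {d = bit _} {upTo _} 3≤n v (bit _ , vs , _ , _ , σ)
  with bit-bit-upTo 3≤n vs (sumsToZero-rotate σ)
... | refl , inj₁ (refl , refl) = proj₂ (∈-partners-bit₁ v)
... | refl , inj₂ (refl , refl) = proj₂ (∈-partners-bit₂ v)
partners-complete {d = upTo _} {bit _} _ v (upTo _ , vs , vd , vt , σ) with bit-upTo-upTo vs vd vt σ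
... | inj₁ (refl , _) = bit∈partners-upTo v
... | inj₂ (_ , refl) = proj₁ (∈-partners-upTo-above (proj₂ vs) v)
partners-complete {d = bit _} {upTo _} _ v (upTo _ , vs , vd , vt , σ)
  with bit-upTo-upTo vd vs vt (sumsToZero-swap σ)
... | inj₁ (refl , refl) = proj₂ (∈-partners-bit₃₊ (proj₁ vt) v)
... | inj₂ (refl , refl) = proj₁ (∈-partners-bit₃₊ (proj₁ vs) v)
partners-complete {d = upTo _} {upTo _} _ v (bit _ , vs , vd , vt , σ)
  with bit-upTo-upTo vt vs vd (sumsToZero-rotate (sumsToZero-rotate σ))
... | inj₁ (refl , refl) = proj₂ (∈-partners-upTo-above (proj₂ vt) v)
... | inj₂ (refl , refl) = upTo-pred∈partners-upTo (proj₁ vs) v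

partners-unique : ∀ {n d} (v : Kind n d) → Unique (partners v)
partners-unique bit₁           = ((λ ()) ∷ []) ∷ [] ∷ []
partners-unique bit₂           = ((λ ()) ∷ []) ∷ [] ∷ []
partners-unique (bit₃₊ _)      = ((λ ()) ∷ []) ∷ [] ∷ []
partners-unique upTo₂          = ((λ ()) ∷ (λ ()) ∷ (λ ()) ∷ []) ∷ ((λ ()) ∷ (λ ()) ∷ []) ∷ ((λ ()) ∷ []) ∷ [] ∷ []
partners-unique (upTo-inner _) = ((λ ()) ∷ (λ ()) ∷ (λ ()) ∷ []) ∷ ((λ ()) ∷ (λ ()) ∷ []) ∷ ((λ ()) ∷ []) ∷ [] ∷ []
partners-unique upTo-top       = ((λ ()) ∷ []) ∷ [] ∷ []

partners-length : ∀ {n d} (v : Kind n d) → length (partners v) ≡ 2 ⊎ length (partners v) ≡ 4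
partners-length bit₁           = inj₁ refl
partners-length bit₂           = inj₁ refl
partners-length (bit₃₊ _)      = inj₁ refl
partners-length upTo₂          = inj₂ refl
partners-length (upTo-inner _) = inj₂ refl
partners-length upTo-top       = inj₁ refl

lemma2p4 : (n : ℕ) → 3 ≤ n → (X Y : Vertex n) → Adjacent n X Y →
    Σ (List (Vertex n)) λ L →
    Unique L × (∀ Z → (Z ∈ L) ⇔ CommonNeighbour n X Y Z) ×
    (length L ≡ 2 ⊎ length L ≡ 4)
lemma2p4 n 3≤n X Y adj with Equivalence.to adjacent⇔ adj
... | d , vd , refl =
  map neighbour (partners v) ,
  unique-map⁺ neighbour (act-injective X) (All.map partner-valid (partners-sound 3≤n v)) (partners-unique v) ,
  (λ Z → mk⇔ (sound Z) (complete Z)) ,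
  subst (λ m → m ≡ 2 ⊎ m ≡ 4) (sym (length-map neighbour (partners v))) (partners-length v)
  where
  v : Kind n d
  v = kind d vd
  neighbour : Generator → Vertex n
  neighbour s = act s X
  sound : ∀ Z → Z ∈ map neighbour (partners v) → CommonNeighbour n X (act d X) Z
  sound Z Z∈ with ∈-map⁻ neighbour Z∈
  ... | s , s∈ , refl = Equivalence.from (commonNeighbour⇔ X vd) (s , All.lookup (partners-sound 3≤n v) s∈ , refl)
  complete : ∀ Z → CommonNeighbour n X (act d X) Z → Z ∈ map neighbour (partners v)
  complete Z cn with Equivalence.to (commonNeighbour⇔ X vd) cn
  ... | s , partner , refl = ∈-map⁺ neighbour (partners-complete 3≤n v partner)
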